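{- Every lattice quotient of a lattice with CLSP is a retract of that lattice.
   Context: A lattice quotient of a lattice $P$ is a lattice $Q$ with a surjective lattice homomorphism $P\to Q$. $Q$ is a retract of $P$ if there are order preserving maps $s:Q\to P$, $r:P\to Q$ with $r\circ s=\mathrm{id}_Q$. For a lattice $T$, $\mathcal{C}_L(T)$ is the set of nonempty convex sublattices of $T$ ordered by the bi-dominating order ($X\le Y$ iff every element of $X$ is below some element of $Y$ and every element of $Y$ is above some element of $X$); $T$ has CLSP if there is an order preserving $\varphi:\mathcal{C}_L(T)\to T$ with $\varphi(S)\in S$ for all $S$. -}

module Defs where

open import Level using (Level; _⊔_; suc; Setω)
open import Data.Product using (Σ; ∃; _×_; _,_; proj₁; proj₂)
open import Relation.Binary.Lattice.Bundles using (Lattice)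

module _ {c ℓ₁ ℓ₂ c' ℓ₁' ℓ₂' : Level}
         (P : Lattice c ℓ₁ ℓ₂) (Q : Lattice c' ℓ₁' ℓ₂') where
  private
    module P = Lattice P
    module Q = Lattice Q

  OrderPreserving : (P.Carrier → Q.Carrier) → Set (c ⊔ ℓ₂ ⊔ ℓ₂')
  OrderPreserving f = ∀ {x y} → x P.≤ y → f x Q.≤ f y

module _ {c ℓ₁ ℓ₂ c' ℓ₁' ℓ₂' : Level}
         (P : Lattice c ℓ₁ ℓ₂) (Q : Lattice c' ℓ₁' ℓ₂') where
  private
    module P = Lattice P
    module Q = Lattice Q

  record IsLatticeHom (f : P.Carrier → Q.Carrier) : Set (c ⊔ ℓ₁ ⊔ ℓ₁') where
    field
      cong  : ∀ {x y} → x P.≈ y → f x Q.≈ f y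
      ∨-hom : ∀ x y → f (x P.∨ y) Q.≈ (f x Q.∨ f y)
      ∧-hom : ∀ x y → f (x P.∧ y) Q.≈ (f x Q.∧ f y)

  Surjective : (P.Carrier → Q.Carrier) → Set (c ⊔ c' ⊔ ℓ₁')
  Surjective f = ∀ q → ∃ λ p → f p Q.≈ q

  IsLatticeQuotient : Set (c ⊔ c' ⊔ ℓ₁ ⊔ ℓ₁')
  IsLatticeQuotient = Σ (P.Carrier → Q.Carrier) λ f → IsLatticeHom f × Surjective f

  IsRetract : Set (c ⊔ c' ⊔ ℓ₁' ⊔ ℓ₂ ⊔ ℓ₂')
  IsRetract = Σ (Q.Carrier → P.Carrier) λ s → Σ (P.Carrier → Q.Carrier) λ r →
    OrderPreserving Q P s × OrderPreserving P Q r × (∀ q → r (s q) Q.≈ q)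

module _ {c ℓ₁ ℓ₂ : Level} (T : Lattice c ℓ₁ ℓ₂) where
  open Lattice T

  record ConvexSublattice (ℓs : Level) : Set (c ⊔ ℓ₁ ⊔ ℓ₂ ⊔ suc ℓs) where
    field
      mem      : Carrier → Set ℓs
      resp     : ∀ {x y} → x ≈ y → mem x → mem y
      nonempty : ∃ λ x → mem x
      ∨-closed : ∀ {x y} → mem x → mem y → mem (x ∨ y)
      ∧-closed : ∀ {x y} → mem x → mem y → mem (x ∧ y)
      convex   : ∀ {x y z} → mem x → mem y → x ≤ z → z ≤ y → mem z
  open ConvexSublattice public

  _≤bi_ : ∀ {ℓs} → ConvexSublattice ℓs → ConvexSublattice ℓs → Set (c ⊔ ℓ₂ ⊔ ℓs)
  X ≤bi Y = (∀ x → mem X x → ∃ λ y → mem Y y × x ≤ y)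
          × (∀ y → mem Y y → ∃ λ x → mem X x × x ≤ y)

  CLSPAt : (ℓs : Level) → Set (c ⊔ ℓ₁ ⊔ ℓ₂ ⊔ suc ℓs)
  CLSPAt ℓs = Σ (ConvexSublattice ℓs → Carrier) λ φ →
      (∀ {X Y} → X ≤bi Y → φ X ≤ φ Y) × (∀ S → mem S (φ S))

  -- T has CLSP: a selection as above exists for the convex sublattices at
  -- every universe level (predicative rendering of "all subsets")
  HasCLSP : Setω
  HasCLSP = ∀ ℓs → CLSPAt ℓs

-- The fibres f⁻¹(q) of a surjective lattice homomorphism f : P → Q are nonempty
-- convex sublattices of P, and q ≤ q' implies f⁻¹(q) ≤ f⁻¹(q') in the
-- bi-dominating order (join, resp. meet, with a point of the other fibre).
-- A CLSP selection φ therefore yields the monotone section q ↦ φ(f⁻¹(q)) of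
-- the monotone retraction f.
module Submission where

open import Defs
open import Level using (Level)
open import Data.Product using (∃; _,_)
open import Relation.Binary.Lattice.Bundles using (Lattice)
import Relation.Binary.Lattice.Properties.JoinSemilattice as JoinProperties
import Relation.Binary.Lattice.Properties.MeetSemilattice as MeetProperties
import Relation.Binary.Reasoning.Setoid as ≈-Reasoning

module LatticeHomProperties
    {c ℓ₁ ℓ₂ c' ℓ₁' ℓ₂' : Level}
    {P : Lattice c ℓ₁ ℓ₂} {Q : Lattice c' ℓ₁' ℓ₂'}
    {f : Lattice.Carrier P → Lattice.Carrier Q} (hom : IsLatticeHom P Q f) where
  private
    module P = Lattice P
    module Q = Lattice Q
    module PM = MeetProperties P.meetSemilattice
    module QJ = JoinProperties Q.joinSemilattice
    module QM = MeetProperties Q.meetSemilattice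
  open IsLatticeHom hom
  open ≈-Reasoning Q.setoid

  monotone : OrderPreserving P Q f
  monotone {x} {y} x≤y = Q.trans (Q.reflexive f[x]≈fy∧fx) (Q.x∧y≤x (f y) (f x))
    where
    f[x]≈fy∧fx : f x Q.≈ f y Q.∧ f x
    f[x]≈fy∧fx = begin
      f x         ≈⟨ cong (P.Eq.sym (PM.y≤x⇒x∧y≈y x≤y)) ⟩
      f (y P.∧ x) ≈⟨ ∧-hom y x ⟩
      f y Q.∧ f x ∎

  ∨-image : ∀ {x y q q'} → f x Q.≈ q → f y Q.≈ q' → q Q.≤ q' → f (x P.∨ y) Q.≈ q'
  ∨-image {x} {y} {q} {q'} fx≈q fy≈q' q≤q' = begin
    f (x P.∨ y)  ≈⟨ ∨-hom x y ⟩
    f x Q.∨ f y  ≈⟨ QJ.∨-cong fx≈q fy≈q' ⟩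
    q Q.∨ q'     ≈⟨ QJ.x≤y⇒x∨y≈y q≤q' ⟩
    q'           ∎

  ∧-image : ∀ {x y q q'} → f x Q.≈ q' → f y Q.≈ q → q Q.≤ q' → f (x P.∧ y) Q.≈ q
  ∧-image {x} {y} {q} {q'} fx≈q' fy≈q q≤q' = begin
    f (x P.∧ y)  ≈⟨ ∧-hom x y ⟩
    f x Q.∧ f y  ≈⟨ QM.∧-cong fx≈q' fy≈q ⟩
    q' Q.∧ q     ≈⟨ QM.y≤x⇒x∧y≈y q≤q' ⟩
    q            ∎

  fibre : ∀ q → ∃ (λ p → f p Q.≈ q) → ConvexSublattice P ℓ₁'
  fibre q inhabited = record
    { mem      = λ p → f p Q.≈ q
    ; resp     = λ x≈y fx≈q → Q.Eq.trans (cong (P.Eq.sym x≈y)) fx≈q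
    ; nonempty = inhabited
    ; ∨-closed = λ fx≈q fy≈q → ∨-image fx≈q fy≈q Q.refl
    ; ∧-closed = λ fx≈q fy≈q → ∧-image fx≈q fy≈q Q.refl
    ; convex   = λ fx≈q fy≈q x≤z z≤y →
        Q.antisym (Q.trans (monotone z≤y) (Q.reflexive fy≈q))
                  (Q.trans (Q.reflexive (Q.Eq.sym fx≈q)) (monotone x≤z))
    }

  fibre-monotone : ∀ {q q'} (a : ∃ λ p → f p Q.≈ q) (b : ∃ λ p → f p Q.≈ q') →
                   q Q.≤ q' → _≤bi_ P (fibre q a) (fibre q' b)
  fibre-monotone (x₀ , fx₀≈q) (y₀ , fy₀≈q') q≤q' =
    (λ x fx≈q  → x P.∨ y₀ , ∨-image fx≈q fy₀≈q' q≤q' , P.x≤x∨y x y₀) ,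
    (λ y fy≈q' → y P.∧ x₀ , ∧-image fy≈q' fx₀≈q q≤q' , P.x∧y≤x y x₀)

CLSPAt⇒quotient-retract : ∀ {c ℓ₁ ℓ₂ c' ℓ₁' ℓ₂' : Level}
    (P : Lattice c ℓ₁ ℓ₂) (Q : Lattice c' ℓ₁' ℓ₂') →
    CLSPAt P ℓ₁' → IsLatticeQuotient P Q → IsRetract P Q
CLSPAt⇒quotient-retract P Q (φ , φ-monotone , φ-selects) (f , hom , surj) =
  section , f ,
  (λ q≤q' → φ-monotone (fibre-monotone (surj _) (surj _) q≤q')) ,
  monotone ,
  (λ q → φ-selects (fibre q (surj q)))
  where
  open LatticeHomProperties hom

  section : Lattice.Carrier Q → Lattice.Carrier P
  section q = φ (fibre q (surj q))

mainTheorem12 : ∀ {c ℓ₁ ℓ₂ c' ℓ₁' ℓ₂' : Level}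
    (P : Lattice c ℓ₁ ℓ₂) (Q : Lattice c' ℓ₁' ℓ₂') →
    HasCLSP P → IsLatticeQuotient P Q → IsRetract P Q
mainTheorem12 {ℓ₁' = ℓ₁'} P Q clsp = CLSPAt⇒quotient-retract P Q (clsp ℓ₁')
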